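{- Let $r\ge 1$ be an integer, let $G$ be an $r$-regular graph on $n$ vertices, let $K$ be a finite set of colors, and let $\mathcal{L}$ be a collection of multisets of elements of $K$. Then \[ \ell(G,\mathcal{L})\le N(r,\mathcal{L})^{n/r}=\ell(K_{r,r},\mathcal{L})^{n/(2r)}, \] and \[ \ell_c(G,\mathcal{L})\le N(r+1,\mathcal{L})^{n/(r+1)}=\ell_c(K_{r+1},\mathcal{L})^{n/(r+1)}. \]
   Context: All graphs are finite and simple. For a vertex $v$, $N(v)$ is its open neighborhood (set of neighbors) and $N[v]=N(v)\cup\{v\}$ its closed neighborhood. For a map $\phi:V(G)\to K$ and $A\subseteq V(G)$, $\phi(A)$ denotes the multiset image of $A$ under $\phi$ (each color counted with the number of vertices of $A$ receiving it). A map $\phi:V(G)\to K$ is an $\mathcal{L}$-legal neighborhood coloring of $G$ if $\phi(N(v))\in\mathcal{L}$ for all $v\in V(G)$, and an $\mathcal{L}$-legal closed neighborhood coloring if $\phi(N[v])\in\mathcal{L}$ for all $v\in V(G)$. $\ell(G,\mathcal{L})$ is the number of $\mathcal{L}$-legal neighborhood colorings of $G$ and $\ell_c(G,\mathcal{L})$ the number of $\mathcal{L}$-legal closed neighborhood colorings of $G$. For an integer $s\ge 1$, $N(s,\mathcal{L})$ is the number of functions $f:\{1,\dots,s\}\to K$ whose multiset image $f(\{1,\dots,s\})$ lies in $\mathcal{L}$. $K_{r,r}$ is the complete bipartite graph with both parts of size $r$ and $K_{r+1}$ the complete graph on $r+1$ vertices. -}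

module Defs where

open import Data.Nat using (ℕ; zero; suc; _+_; _<ᵇ_)
open import Data.Bool using (Bool; true; false; if_then_else_; _∧_; _∨_; not; _xor_)
open import Data.Bool.Properties using (xor-comm; xor-same)
open import Data.Fin using (Fin; zero; suc; toℕ)
open import Data.Fin.Properties using (_≟_)
open import Data.Vec using (Vec; []; _∷_; lookup; tabulate)
open import Data.List using (List; []; _∷_; map; allFin; concatMap; length; filterᵇ; [_])
open import Relation.Nullary.Decidable using (⌊_⌋)
open import Relation.Binary.PropositionalEquality using (_≡_; refl)

countF : ∀ {n} → (Fin n → Bool) → ℕ
countF {zero} p = 0
countF {suc n} p = (if p zero then 1 else 0) + countF (λ i → p (suc i))

record Graph (n : ℕ) : Set where
  field
    adj   : Fin n → Fin n → Bool
    adj-sym : ∀ u v → adj u v ≡ adj v u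
    adj-irrefl : ∀ v → adj v v ≡ false
open Graph public

degree : ∀ {n} → Graph n → Fin n → ℕ
degree G v = countF (adj G v)

Regular : ∀ {n} → ℕ → Graph n → Set
Regular r G = ∀ v → degree G v ≡ r

-- Multisets over the color set K = Fin k, as multiplicity vectors
Multiset : ℕ → Set
Multiset k = Vec ℕ k

Collection : ℕ → Set
Collection k = Multiset k → Bool

Coloring : ℕ → ℕ → Set
Coloring n k = Vec (Fin k) n

allColorings : ∀ n k → List (Coloring n k)
allColorings zero k = [ [] ]
allColorings (suc n) k =
  concatMap (λ c → map (c ∷_) (allColorings n k)) (allFin k)

-- multiset image φ(A) of A ⊆ Fin n (given by a mask)
image : ∀ {n k} → Coloring n k → (Fin n → Bool) → Multiset k
image φ A = tabulate (λ c → countF (λ v → A v ∧ ⌊ lookup φ v ≟ c ⌋))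

openNbhd : ∀ {n} → Graph n → Fin n → (Fin n → Bool)
openNbhd G v u = adj G v u

closedNbhd : ∀ {n} → Graph n → Fin n → (Fin n → Bool)
closedNbhd G v u = adj G v u ∨ ⌊ u ≟ v ⌋

allV : ∀ {n} → (Fin n → Bool) → Bool
allV {zero} p = true
allV {suc n} p = p zero ∧ allV (λ i → p (suc i))

ℓ : ∀ {n k} → Graph n → Collection k → ℕ
ℓ {n} {k} G L =
  length (filterᵇ (λ φ → allV (λ v → L (image φ (openNbhd G v)))) (allColorings n k))

ℓc : ∀ {n k} → Graph n → Collection k → ℕ
ℓc {n} {k} G L =
  length (filterᵇ (λ φ → allV (λ v → L (image φ (closedNbhd G v)))) (allColorings n k))

Ncount : ∀ {k} → ℕ → Collection k → ℕ
Ncount {k} s L = length (filterᵇ (λ f → L (image f (λ _ → true))) (allColorings s k))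

-- K_{r,r} on Fin (r + r): parts {i < r} and {i ≥ r}
Krr : (r : ℕ) → Graph (r + r)
Krr r = record
  { adj = λ u v → (toℕ u <ᵇ r) xor (toℕ v <ᵇ r)
  ; adj-sym = λ u v → xor-comm (toℕ u <ᵇ r) (toℕ v <ᵇ r)
  ; adj-irrefl = λ v → xor-same (toℕ v <ᵇ r) }

Kcomplete : (m : ℕ) → Graph m
Kcomplete m = record
  { adj = λ u v → not ⌊ u ≟ v ⌋
  ; adj-sym = symK
  ; adj-irrefl = irrK }
  where
  open import Relation.Nullary using (yes; no)
  open import Relation.Binary.PropositionalEquality renaming (sym to ≡sym)
  symK : ∀ u v → not ⌊ u ≟ v ⌋ ≡ not ⌊ v ≟ u ⌋
  symK u v with u ≟ v | v ≟ u
  ... | yes _ | yes _ = refl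
  ... | no _ | no _ = refl
  ... | yes p | no q = Data.Empty.⊥-elim (q (≡sym p)) where import Data.Empty
  ... | no p | yes q = Data.Empty.⊥-elim (p (≡sym q)) where import Data.Empty
  irrK : ∀ v → not ⌊ v ≟ v ⌋ ≡ false
  irrK v with v ≟ v
  ... | yes _ = refl
  ... | no p = Data.Empty.⊥-elim (p refl) where import Data.Empty

module Submission where

-- View a colouring φ of the n vertices as a point of K^n and, for each vertex v,
-- the condition "φ(N(v)) ∈ 𝓛" as a predicate depending only on the coordinates
-- in N(v).

open import Data.Nat using (ℕ; zero; suc; _+_; _*_; _^_; _≤_; _<ᵇ_; z≤n; NonZero)
open import Data.Nat.Properties hiding (_≟_)
open import Data.Nat.Tactic.RingSolver using (solve-∀)
open import Data.Bool using (Bool; true; false; if_then_else_; _∧_; _∨_; not; T)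
open import Data.Bool.Properties using (∧-identityʳ; ∨-identityʳ; ∨-inverseˡ; not-¬)
open import Data.Fin using (Fin; zero; suc; toℕ; _↑ʳ_)
open import Data.Fin.Properties using (_≟_; toℕ-↑ʳ)
open import Data.Vec using ([]; _∷_; lookup; tabulate)
open import Data.Vec.Properties using (tabulate-cong)
open import Data.List using (List; _∷_; map; length; filterᵇ)
import Data.List as List
open import Data.List.Properties using (length-++; filter-++; filter-≐)
open import Data.Product using (_×_; _,_; Σ-syntax)
open import Data.Sum using (inj₁; inj₂)
open import Data.Empty using (⊥-elim)
open import Function using (_∘_)
open import Relation.Nullary.Decidable using (⌊_⌋; yes; no; T?)
open import Relation.Binary.PropositionalEquality
open import Algebra.Properties.Semiring.Sum +-*-semiring
  using (sum; sum-cong-≗; sum-replicate-zero; ∑-comm; *-distribʳ-sum)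
open import Algebra.Properties.CommutativeMonoid.Sum *-1-commutativeMonoid
  using () renaming (sum to product; sum-cong-≗ to product-cong; ∑-distrib-+ to product-distrib-*)
open import Defs

^-distribʳ-* : ∀ a b t → (a * b) ^ t ≡ a ^ t * b ^ t
^-distribʳ-* a b zero = refl
^-distribʳ-* a b (suc t) =
  trans (cong (a * b *_) (^-distribʳ-* a b t)) ([m*n]*[o*p]≡[m*o]*[n*p] a b (a ^ t) (b ^ t))

0^t≡0 : ∀ t .{{_ : NonZero t}} → 0 ^ t ≡ 0
0^t≡0 (suc t) = refl

^-cancelˡ-≤ : ∀ t .{{_ : NonZero t}} {u w} → u ^ t ≤ w ^ t → u ≤ w
^-cancelˡ-≤ t {u} {w} uᵗ≤wᵗ with ≤-<-connex u w
... | inj₁ u≤w = u≤w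
... | inj₂ w<u = ⊥-elim (<⇒≱ (^-monoˡ-< t w<u) uᵗ≤wᵗ)

-- Rearrangement for A ≤ B: A·B^s + A^s·B ≤ A^(s+1) + B^(s+1), i.e. (B-A)(B^s-A^s) ≥ 0.
rearrangement-ordered : ∀ s {A B} → A ≤ B → A * B ^ s + A ^ s * B ≤ A ^ suc s + B ^ suc s
rearrangement-ordered s {A} A≤B with m≤n⇒∃[o]m+o≡n A≤B
... | d , refl = subst₂ _≤_ (sym (lhs A d X Y)) (sym (rhs A d X Y))
  (+-monoʳ-≤ (A * X + A * Y) (*-monoʳ-≤ d (^-monoˡ-≤ s (m≤m+n A d))))
  where
  X : ℕ
  X = (A + d) ^ s
  Y : ℕ
  Y = A ^ s
  lhs : ∀ A d X Y → A * X + Y * (A + d) ≡ A * X + A * Y + d * Y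
  lhs = solve-∀
  rhs : ∀ A d X Y → A * Y + (A + d) * X ≡ A * X + A * Y + d * X
  rhs = solve-∀

rearrangement : ∀ s A B → A * B ^ s + A ^ s * B ≤ A ^ suc s + B ^ suc s
rearrangement s A B with ≤-total A B
... | inj₁ A≤B = rearrangement-ordered s A≤B
... | inj₂ B≤A = subst₂ _≤_ (swap B A (B ^ s) (A ^ s)) (+-comm (B ^ suc s) (A ^ suc s))
                   (rearrangement-ordered s B≤A)
  where
  swap : ∀ B A Bˢ Aˢ → B * Aˢ + Bˢ * A ≡ A * Bˢ + Aˢ * B
  swap = solve-∀

weighted-amgm : ∀ t A B → suc t * A * B ^ t ≤ A ^ suc t + t * B ^ suc t
weighted-amgm zero A B = ≤-reflexive (base A)
  where
  base : ∀ A → (1 + 0) * A * 1 ≡ A * 1 + 0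
  base = solve-∀
weighted-amgm (suc t) A B = +-cancelʳ-≤ (A * Aᵗ * B) _ _
  (subst₂ _≤_ (lhs t A B Bᵗ Aᵗ) (rhs t A B Bᵗ Aᵗ)
    (+-mono-≤ (*-monoˡ-≤ B (weighted-amgm t A B)) (rearrangement (suc t) A B)))
  where
  Bᵗ : ℕ
  Bᵗ = B ^ t
  Aᵗ : ℕ
  Aᵗ = A ^ t
  lhs : ∀ t A B Bᵗ Aᵗ → suc t * A * Bᵗ * B + (A * (B * Bᵗ) + A * Aᵗ * B)
                        ≡ suc (suc t) * A * (B * Bᵗ) + A * Aᵗ * B
  lhs = solve-∀
  rhs : ∀ t A B Bᵗ Aᵗ → (A * Aᵗ + t * (B * Bᵗ)) * B + (A * (A * Aᵗ) + B * (B * Bᵗ))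
                        ≡ A * (A * Aᵗ) + suc t * (B * (B * Bᵗ)) + A * Aᵗ * B
  rhs = solve-∀

-- AM–GM for t copies of S/t and one copy of x, cleared of denominators:
-- (t+1)^(t+1)·x·S^t ≤ t^t·(S+x)^(t+1).  It is weighted-amgm for A = t(S+x),
-- B = (t+1)S, divided by t.
amgm-step : ∀ t .{{_ : NonZero t}} x S → suc t ^ suc t * x * S ^ t ≤ t ^ t * (S + x) ^ suc t
amgm-step t x S = *-cancelˡ-≤ t (+-cancelʳ-≤ (t * (suc t * U * S * W)) _ _
  (subst₂ _≤_ (lhs t x S U W) (rhs t x S tᵗ U W Z) amgm))
  where
  tᵗ : ℕ
  tᵗ = t ^ t
  U : ℕ
  U = suc t ^ t
  W : ℕ
  W = S ^ t
  Z : ℕ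
  Z = (S + x) ^ t
  amgm : suc t * (t * (S + x)) * (U * W) ≤ (t * tᵗ) * ((S + x) * Z) + t * ((suc t * U) * (S * W))
  amgm = subst₂ _≤_
    (cong (suc t * (t * (S + x)) *_) (^-distribʳ-* (suc t) S t))
    (cong₂ _+_ (^-distribʳ-* t (S + x) (suc t)) (cong (t *_) (^-distribʳ-* (suc t) S (suc t))))
    (weighted-amgm t (t * (S + x)) (suc t * S))
  lhs : ∀ t x S U W → suc t * (t * (S + x)) * (U * W) ≡ t * ((suc t * U) * x * W) + t * (suc t * U * S * W)
  lhs = solve-∀
  rhs : ∀ t x S tᵗ U W Z → (t * tᵗ) * ((S + x) * Z) + t * ((suc t * U) * (S * W))
                          ≡ t * (tᵗ * ((S + x) * Z)) + t * (suc t * U * S * W)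
  rhs = solve-∀

infix 10 ∏⟨_⟩_ ∑⟨_⟩_

∏⟨_⟩_ : ∀ {n} → (Fin n → Bool) → (Fin n → ℕ) → ℕ
∏⟨ p ⟩ h = product (λ v → if p v then h v else 1)

∑⟨_⟩_ : ∀ {n} → (Fin n → Bool) → (Fin n → ℕ) → ℕ
∑⟨ p ⟩ h = sum (λ v → if p v then h v else 0)

_∖_ : ∀ {n} → (Fin n → Bool) → Fin n → (Fin n → Bool)
(p ∖ v) u = p u ∧ not ⌊ u ≟ v ⌋

∏⟨⟩-cong : ∀ {n} (p : Fin n → Bool) {h h′ : Fin n → ℕ} →
           (∀ v → p v ≡ true → h v ≡ h′ v) → ∏⟨ p ⟩ h ≡ ∏⟨ p ⟩ h′
∏⟨⟩-cong p {h} {h′} h≡h′ = product-cong selected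
  where
  selected : ∀ v → (if p v then h v else 1) ≡ (if p v then h′ v else 1)
  selected v with p v in pv
  ... | true = h≡h′ v pv
  ... | false = refl

∏⟨⟩-* : ∀ {n} (p : Fin n → Bool) (h h′ : Fin n → ℕ) →
        ∏⟨ p ⟩ (λ v → h v * h′ v) ≡ ∏⟨ p ⟩ h * ∏⟨ p ⟩ h′
∏⟨⟩-* p h h′ = trans (product-cong pointwise)
  (product-distrib-* (λ v → if p v then h v else 1) (λ v → if p v then h′ v else 1))
  where
  pointwise : ∀ v → (if p v then h v * h′ v else 1) ≡ (if p v then h v else 1) * (if p v then h′ v else 1)
  pointwise v with p v
  ... | true = refl
  ... | false = refl

∏-split : ∀ {n} (p : Fin n → Bool) (h : Fin n → ℕ) → product h ≡ ∏⟨ p ⟩ h * ∏⟨ not ∘ p ⟩ h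
∏-split p h = trans (product-cong pointwise)
  (product-distrib-* (λ v → if p v then h v else 1) (λ v → if not (p v) then h v else 1))
  where
  pointwise : ∀ v → h v ≡ (if p v then h v else 1) * (if not (p v) then h v else 1)
  pointwise v with p v
  ... | true = sym (*-identityʳ (h v))
  ... | false = sym (+-identityʳ (h v))

∏-const : ∀ {n} x → product {n} (λ _ → x) ≡ x ^ n
∏-const {zero} x = refl
∏-const {suc n} x = cong (x *_) (∏-const {n} x)

∏⟨⟩-const : ∀ {n} (p : Fin n → Bool) x → ∏⟨ p ⟩ (λ _ → x) ≡ x ^ countF p
∏⟨⟩-const {zero} p x = refl
∏⟨⟩-const {suc n} p x with p zero
... | true = cong (x *_) (∏⟨⟩-const (p ∘ suc) x)
... | false = trans (+-identityʳ _) (∏⟨⟩-const (p ∘ suc) x)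

∏⟨⟩-scale : ∀ {n} (p : Fin n → Bool) x (h : Fin n → ℕ) →
            ∏⟨ p ⟩ (λ v → x * h v) ≡ x ^ countF p * ∏⟨ p ⟩ h
∏⟨⟩-scale p x h = trans (∏⟨⟩-* p (λ _ → x) h) (cong (_* ∏⟨ p ⟩ h) (∏⟨⟩-const p x))

∏⟨⟩-remove : ∀ {n} (p : Fin n → Bool) (h : Fin n → ℕ) v → p v ≡ true →
             ∏⟨ p ⟩ h ≡ h v * ∏⟨ p ∖ v ⟩ h
∏⟨⟩-remove {suc n} p h zero pv rewrite pv =
  cong (h zero *_) (sym (trans (+-identityʳ _) (product-cong rest)))
  where
  rest : ∀ u → (if p (suc u) ∧ true then h (suc u) else 1) ≡ (if p (suc u) then h (suc u) else 1)
  rest u = cong (λ b → if b then h (suc u) else 1) (∧-identityʳ (p (suc u)))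
∏⟨⟩-remove {suc n} p h (suc v) pv =
  trans (cong (first *_) (∏⟨⟩-remove (p ∘ suc) (h ∘ suc) v pv))
        (trans (x*[y*z]≡y*[x*z] first (h (suc v)) _)
               (cong (λ z → h (suc v) * z) (cong₂ _*_ firstEq (product-cong tailEq))))
  where
  first : ℕ
  first = if p zero then h zero else 1
  firstEq : first ≡ (if p zero ∧ true then h zero else 1)
  firstEq = cong (λ b → if b then h zero else 1) (sym (∧-identityʳ (p zero)))
  tailEq : ∀ u → (if ((p ∘ suc) ∖ v) u then h (suc u) else 1) ≡ (if (p ∖ suc v) (suc u) then h (suc u) else 1)
  tailEq u with u ≟ v
  ... | yes refl = refl
  ... | no _ = refl
  x*[y*z]≡y*[x*z] : ∀ x y z → x * (y * z) ≡ y * (x * z)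
  x*[y*z]≡y*[x*z] = solve-∀

∏⟨⟩-zero⇒ : ∀ {n} (p : Fin n → Bool) (h : Fin n → ℕ) → ∏⟨ p ⟩ h ≡ 0 →
            Σ[ v ∈ Fin n ] (p v ≡ true × h v ≡ 0)
∏⟨⟩-zero⇒ {suc n} p h ∏≡0 with p zero in p0 | m*n≡0⇒m≡0∨n≡0 (if p zero then h zero else 1) ∏≡0
... | true | inj₁ h0≡0 = zero , p0 , h0≡0
... | _ | inj₂ rest≡0 with ∏⟨⟩-zero⇒ (p ∘ suc) (h ∘ suc) rest≡0
...   | v , pv , hv≡0 = suc v , pv , hv≡0

∏⟨⟩-has-zero : ∀ {n} (p : Fin n → Bool) (h : Fin n → ℕ) v → p v ≡ true → h v ≡ 0 → ∏⟨ p ⟩ h ≡ 0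
∏⟨⟩-has-zero {suc n} p h zero pv hv≡0 rewrite pv | hv≡0 = refl
∏⟨⟩-has-zero {suc n} p h (suc v) pv hv≡0 rewrite ∏⟨⟩-has-zero (p ∘ suc) (h ∘ suc) v pv hv≡0 =
  *-zeroʳ (if p zero then h zero else 1)

sum-zero⇒ : ∀ {n} (f : Fin n → ℕ) → sum f ≡ 0 → ∀ c → f c ≡ 0
sum-zero⇒ {suc n} f eq zero = m+n≡0⇒m≡0 (f zero) eq
sum-zero⇒ {suc n} f eq (suc c) = sum-zero⇒ (f ∘ suc) (m+n≡0⇒n≡0 (f zero) eq) c

sum-const : ∀ {n} x → sum {n} (λ _ → x) ≡ n * x
sum-const {zero} x = refl
sum-const {suc n} x = cong (x +_) (sum-const {n} x)

∑⟨⟩-const : ∀ {n} (p : Fin n → Bool) x → ∑⟨ p ⟩ (λ _ → x) ≡ countF p * x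
∑⟨⟩-const {zero} p x = refl
∑⟨⟩-const {suc n} p x with p zero
... | true = cong (x +_) (∑⟨⟩-const (p ∘ suc) x)
... | false = ∑⟨⟩-const (p ∘ suc) x

-- One induction step of AM–GM over a mask: from c^c·π ≤ σ^c (for c terms with
-- product π and sum σ) to the same bound with the term Q₀ added when b holds;
-- the new term is absorbed by amgm-step.
amgm-extend : ∀ b c Q₀ {π σ} → c ^ c * π ≤ σ ^ c →
  ((if b then 1 else 0) + c) ^ ((if b then 1 else 0) + c) * ((if b then Q₀ else 1) * π)
    ≤ ((if b then Q₀ else 0) + σ) ^ ((if b then 1 else 0) + c)
amgm-extend false c Q₀ {π} {σ} ih = subst (_≤ σ ^ c) (cong (c ^ c *_) (sym (+-identityʳ π))) ih
amgm-extend true zero Q₀ {π} {σ} π≤1 = begin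
  1 * (Q₀ * π)     ≡⟨ *-identityˡ (Q₀ * π) ⟩
  Q₀ * π           ≤⟨ *-monoʳ-≤ Q₀ (subst (_≤ 1) (+-identityʳ π) π≤1) ⟩
  Q₀ * 1           ≡⟨ *-identityʳ Q₀ ⟩
  Q₀               ≤⟨ m≤m+n Q₀ σ ⟩
  Q₀ + σ           ≡⟨ sym (*-identityʳ _) ⟩
  (Q₀ + σ) ^ 1     ∎
  where open ≤-Reasoning
amgm-extend true c@(suc _) Q₀ {π} {σ} ih = *-cancelˡ-≤ (c ^ c) {{m^n≢0 c c}} (begin
  c ^ c * (suc c ^ suc c * (Q₀ * π)) ≡⟨ regroup (c ^ c) (suc c ^ suc c) Q₀ π ⟩
  suc c ^ suc c * Q₀ * (c ^ c * π)   ≤⟨ *-monoʳ-≤ (suc c ^ suc c * Q₀) ih ⟩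
  suc c ^ suc c * Q₀ * σ ^ c         ≤⟨ amgm-step c Q₀ σ ⟩
  c ^ c * (σ + Q₀) ^ suc c           ≡⟨ cong (λ s → c ^ c * s ^ suc c) (+-comm σ Q₀) ⟩
  c ^ c * (Q₀ + σ) ^ suc c           ∎)
  where
  open ≤-Reasoning
  regroup : ∀ a b q p → a * (b * (q * p)) ≡ b * q * (a * p)
  regroup = solve-∀

amgm : ∀ {n} (p : Fin n → Bool) (Q : Fin n → ℕ) → countF p ^ countF p * ∏⟨ p ⟩ Q ≤ (∑⟨ p ⟩ Q) ^ countF p
amgm {zero} p Q = ≤-refl
amgm {suc n} p Q = amgm-extend (p zero) (countF (p ∘ suc)) (Q zero) (amgm (p ∘ suc) (Q ∘ suc))

monomial-power : ∀ D x x′ a b → (D * x ^ a * x′ ^ b) ^ (a + b) ≡ (D * x ^ (a + b)) ^ a * (D * x′ ^ (a + b)) ^ b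
monomial-power D x x′ a b = begin
  (D * x ^ a * x′ ^ b) ^ (a + b)
    ≡⟨ ^-distribʳ-* (D * x ^ a) (x′ ^ b) (a + b) ⟩
  (D * x ^ a) ^ (a + b) * (x′ ^ b) ^ (a + b)
    ≡⟨ cong (_* (x′ ^ b) ^ (a + b)) (^-distribʳ-* D (x ^ a) (a + b)) ⟩
  D ^ (a + b) * (x ^ a) ^ (a + b) * (x′ ^ b) ^ (a + b)
    ≡⟨ cong₂ (λ d y → d * y * (x′ ^ b) ^ (a + b)) (^-distribˡ-+-* D a b) (transpose x a b) ⟩
  D ^ a * D ^ b * (x ^ (a + b)) ^ a * (x′ ^ b) ^ (a + b)
    ≡⟨ cong (D ^ a * D ^ b * (x ^ (a + b)) ^ a *_) (transpose′ x′ a b) ⟩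
  D ^ a * D ^ b * (x ^ (a + b)) ^ a * (x′ ^ (a + b)) ^ b
    ≡⟨ regroup (D ^ a) (D ^ b) ((x ^ (a + b)) ^ a) ((x′ ^ (a + b)) ^ b) ⟩
  (D ^ a * (x ^ (a + b)) ^ a) * (D ^ b * (x′ ^ (a + b)) ^ b)
    ≡⟨ sym (cong₂ _*_ (^-distribʳ-* D (x ^ (a + b)) a) (^-distribʳ-* D (x′ ^ (a + b)) b)) ⟩
  (D * x ^ (a + b)) ^ a * (D * x′ ^ (a + b)) ^ b  ∎
  where
  open ≡-Reasoning
  transpose : ∀ x a b → (x ^ a) ^ (a + b) ≡ (x ^ (a + b)) ^ a
  transpose x a b = trans (^-*-assoc x a (a + b))
    (trans (cong (x ^_) (*-comm a (a + b))) (sym (^-*-assoc x (a + b) a)))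
  transpose′ : ∀ x a b → (x ^ b) ^ (a + b) ≡ (x ^ (a + b)) ^ b
  transpose′ x a b = trans (cong ((x ^ b) ^_) (+-comm a b))
    (trans (transpose x b a) (cong (λ e → (x ^ e) ^ b) (+-comm b a)))
  regroup : ∀ p q r s → p * q * r * s ≡ (p * r) * (q * s)
  regroup = solve-∀

-- Every monomial of degree t in (x, x′) is dominated,
-- and (x + x′)^t is expanded one factor at a time.
module TwoTerms (t : ℕ) .{{_ : NonZero t}} (D E x x′ y y′ : ℕ)
                (x≤y : D * x ^ t ≤ E * y ^ t) (x′≤y′ : D * x′ ^ t ≤ E * y′ ^ t) where

  monomial-≤ : ∀ a b → a + b ≡ t → D * x ^ a * x′ ^ b ≤ E * y ^ a * y′ ^ b
  monomial-≤ a b refl = ^-cancelˡ-≤ (a + b)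
    (subst₂ _≤_ (sym (monomial-power D x x′ a b)) (sym (monomial-power E y y′ a b))
      (*-mono-≤ (^-monoˡ-≤ a x≤y) (^-monoˡ-≤ b x′≤y′)))

  expand-≤ : ∀ j a b → a + b + j ≡ t →
             D * x ^ a * x′ ^ b * (x + x′) ^ j ≤ E * y ^ a * y′ ^ b * (y + y′) ^ j
  expand-≤ zero a b eq = subst₂ _≤_ (sym (*-identityʳ _)) (sym (*-identityʳ _))
    (monomial-≤ a b (trans (sym (+-identityʳ _)) eq))
  expand-≤ (suc j) a b eq = subst₂ _≤_ (distribute D x x′ (x ^ a) (x′ ^ b) ((x + x′) ^ j))
                                       (distribute E y y′ (y ^ a) (y′ ^ b) ((y + y′) ^ j))
    (+-mono-≤ (expand-≤ j (suc a) b (trans (shiftˡ a b j) eq)) (expand-≤ j a (suc b) (trans (shiftʳ a b j) eq)))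
    where
    distribute : ∀ D x x′ X X′ W → D * (x * X) * X′ * W + D * X * (x′ * X′) * W ≡ D * X * X′ * ((x + x′) * W)
    distribute = solve-∀
    shiftˡ : ∀ a b j → suc a + b + j ≡ a + b + suc j
    shiftˡ = solve-∀
    shiftʳ : ∀ a b j → a + suc b + j ≡ a + b + suc j
    shiftʳ = solve-∀

  sum-≤ : D * (x + x′) ^ t ≤ E * (y + y′) ^ t
  sum-≤ = subst₂ _≤_ (drop-units D _) (drop-units E _) (expand-≤ t 0 0 refl)
    where
    drop-units : ∀ D W → D * 1 * 1 * W ≡ D * W
    drop-units = solve-∀

-- Power-sum monotonicity: if D·x_c^t ≤ E·y_c^t for every c, then D·(∑x)^t ≤ E·(∑y)^t
-- (for real numbers: the map x ↦ (D x^t)^(1/t) is additive).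
∑-pow-mono : ∀ t .{{_ : NonZero t}} D E {k} (x y : Fin k → ℕ) →
             (∀ c → D * x c ^ t ≤ E * y c ^ t) → D * sum x ^ t ≤ E * sum y ^ t
∑-pow-mono t D E {zero} x y _ = subst (_≤ E * 0 ^ t) (sym (trans (cong (D *_) (0^t≡0 t)) (*-zeroʳ D))) z≤n
∑-pow-mono t D E {suc k} x y x≤y = TwoTerms.sum-≤ t D E _ _ _ _ (x≤y zero)
  (∑-pow-mono t D E (x ∘ suc) (y ∘ suc) (x≤y ∘ suc))

∑-pow-vanish : ∀ t .{{_ : NonZero t}} C {k} (f : Fin k → ℕ) → (∀ c → C * f c ^ t ≡ 0) → C * sum f ^ t ≡ 0
∑-pow-vanish t C {k} f vanish = n≤0⇒n≡0 (subst (C * sum f ^ t ≤_) zero-rhs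
  (∑-pow-mono t C 1 f (λ _ → 0) (λ c → ≤-reflexive (trans (vanish c) (sym zero-term)))))
  where
  zero-term : 1 * 0 ^ t ≡ 0
  zero-term = trans (*-identityˡ _) (0^t≡0 t)
  zero-rhs : 1 * sum {k} (λ _ → 0) ^ t ≡ 0
  zero-rhs = trans (cong (λ s → 1 * s ^ t) (sum-replicate-zero k)) zero-term

-- Hölder's inequality for t = |p| selected rows of a nonnegative matrix a:
-- ∑_c ∏_{v∈p} a_{v c}^{1/t} ≤ ∏_{v∈p} (∑_c a_{v c})^{1/t}, stated in integer form
-- with arbitrary weights C and E.  Proof: normalise each row by the product of the
-- other row sums, apply AM–GM in every column and power-sum monotonicity over c.
module Hölder {n k} (p : Fin n → Bool) (a : Fin n → Fin k → ℕ) where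

  t : ℕ
  t = countF p

  rowSum : Fin n → ℕ
  rowSum v = sum (a v)

  P : ℕ
  P = ∏⟨ p ⟩ rowSum

  others : Fin n → ℕ
  others v = ∏⟨ p ∖ v ⟩ rowSum

  R : ℕ
  R = ∏⟨ p ⟩ others

  -- each selected row completes the others to P, hence P·R = P^t
  row*others : ∀ v → p v ≡ true → rowSum v * others v ≡ P
  row*others v pv = sym (∏⟨⟩-remove p rowSum v pv)

  P*R≡P^t : P * R ≡ P ^ t
  P*R≡P^t = trans (sym (∏⟨⟩-* p rowSum others)) (trans (∏⟨⟩-cong p row*others) (∏⟨⟩-const p P))

  -- column c of the normalised matrix, summed over the selected rows
  S : Fin k → ℕ
  S c = ∑⟨ p ⟩ (λ v → a v c * others v)

  -- every selected row of the normalised matrix sums to P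
  ∑S≡t*P : sum S ≡ t * P
  ∑S≡t*P = trans (∑-comm (λ c v → if p v then a v c * others v else 0))
                 (trans (sum-cong-≗ row) (∑⟨⟩-const p P))
    where
    row : ∀ v → sum (λ c → if p v then a v c * others v else 0) ≡ (if p v then P else 0)
    row v with p v in pv
    ... | true = trans (sym (*-distribʳ-sum (others v) (a v))) (row*others v pv)
    ... | false = sum-replicate-zero k

  column-amgm : ∀ c → t ^ t * (∏⟨ p ⟩ (λ v → a v c) * R) ≤ S c ^ t
  column-amgm c = subst (λ z → t ^ t * z ≤ S c ^ t) (∏⟨⟩-* p (λ v → a v c) others) (amgm p (λ v → a v c * others v))

  vanishing-row : P ≡ 0 → ∀ c → ∏⟨ p ⟩ (λ v → a v c) ≡ 0
  vanishing-row P≡0 c with ∏⟨⟩-zero⇒ p rowSum P≡0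
  ... | v , pv , rowSum≡0 = ∏⟨⟩-has-zero p (λ v → a v c) v pv (sum-zero⇒ (a v) rowSum≡0 c)

  -- Hölder: if R = 0 some selected row vanishes; otherwise sum the column
  -- estimates with ∑-pow-mono and cancel t^t·R.
  hölder : .{{_ : NonZero t}} → ∀ C E (f : Fin k → ℕ) →
           (∀ c → C * f c ^ t ≤ ∏⟨ p ⟩ (λ v → a v c) * E) → C * sum f ^ t ≤ P * E
  hölder C E f hyp with R in R-eq
  ... | zero = ≤-trans (≤-reflexive (∑-pow-vanish t C f (λ c → n≤0⇒n≡0 (≤-trans (hyp c)
                   (≤-reflexive (cong (_* E) (vanishing-row P≡0 c))))))) z≤n
    where
    P≡0 : P ≡ 0
    P≡0 = m^n≡0⇒m≡0 P t (trans (sym P*R≡P^t) (trans (cong (P *_) R-eq) (*-zeroʳ P)))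
  ... | suc _ = *-cancelˡ-≤ (t ^ t * R) {{m*n≢0 (t ^ t) R {{m^n≢0 t t}} {{nonzero-R}}}} (begin
    t ^ t * R * (C * sum f ^ t)          ≡⟨ sym (*-assoc (t ^ t * R) C _) ⟩
    t ^ t * R * C * sum f ^ t            ≤⟨ ∑-pow-mono t (t ^ t * R * C) E f S column ⟩
    E * sum S ^ t                        ≡⟨ cong (λ s → E * s ^ t) ∑S≡t*P ⟩
    E * (t * P) ^ t                      ≡⟨ cong (E *_) (^-distribʳ-* t P t) ⟩
    E * (t ^ t * P ^ t)                  ≡⟨ cong (λ z → E * (t ^ t * z)) (sym P*R≡P^t) ⟩
    E * (t ^ t * (P * R))                ≡⟨ regroup E (t ^ t) P R ⟩
    t ^ t * R * (P * E)                  ∎)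
    where
    open ≤-Reasoning
    nonzero-R : NonZero R
    nonzero-R rewrite R-eq = _
    regroup : ∀ e a p r → e * (a * (p * r)) ≡ a * r * (p * e)
    regroup = solve-∀
    column : ∀ c → t ^ t * R * C * f c ^ t ≤ E * S c ^ t
    column c = begin
      t ^ t * R * C * f c ^ t                    ≡⟨ *-assoc (t ^ t * R) C _ ⟩
      t ^ t * R * (C * f c ^ t)                  ≤⟨ *-monoʳ-≤ (t ^ t * R) (hyp c) ⟩
      t ^ t * R * (∏⟨ p ⟩ (λ v → a v c) * E)     ≡⟨ shuffle (t ^ t) R (∏⟨ p ⟩ (λ v → a v c)) E ⟩
      t ^ t * (∏⟨ p ⟩ (λ v → a v c) * R) * E     ≤⟨ *-monoˡ-≤ E (column-amgm c) ⟩
      S c ^ t * E                                ≡⟨ *-comm _ E ⟩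
      E * S c ^ t                                ∎
      where
      shuffle : ∀ a r m e → a * r * (m * e) ≡ a * (m * r) * e
      shuffle = solve-∀

count : ∀ {m k} → (Coloring m k → Bool) → ℕ
count {m} {k} p = length (filterᵇ p (allColorings m k))

count-cong : ∀ {m k} {p q : Coloring m k → Bool} → (∀ φ → p φ ≡ q φ) → count p ≡ count q
count-cong {m} {k} {p} {q} p≡q = cong length
  (filter-≐ (T? ∘ p) (T? ∘ q) ((λ {φ} → subst T (p≡q φ)) , (λ {φ} → subst T (sym (p≡q φ)))) (allColorings m k))

length-filterᵇ-map : ∀ {A B : Set} (p : B → Bool) (f : A → B) (xs : List A) →
                     length (filterᵇ p (map f xs)) ≡ length (filterᵇ (p ∘ f) xs)
length-filterᵇ-map p f List.[] = refl
length-filterᵇ-map p f (x ∷ xs) with p (f x)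
... | true = cong suc (length-filterᵇ-map p f xs)
... | false = length-filterᵇ-map p f xs

count-cons : ∀ {m k} (p : Coloring (suc m) k → Bool) → count p ≡ sum (λ c → count (λ φ → p (c ∷ φ)))
count-cons {m} {k} p = first-colour (λ c → c)
  where
  first-colour : ∀ {j} (g : Fin j → Fin k) →
    length (filterᵇ p (List.concatMap (λ c → map (c ∷_) (allColorings m k)) (List.tabulate g)))
      ≡ sum (λ i → count (λ φ → p (g i ∷ φ)))
  first-colour {zero} g = refl
  first-colour {suc j} g = trans
    (trans (cong length (filter-++ (T? ∘ p) first _)) (length-++ (filterᵇ p first)))
    (cong₂ _+_ (length-filterᵇ-map p (g zero ∷_) (allColorings m k)) (first-colour (g ∘ suc)))
    where
    first : List (Coloring (suc m) k)
    first = map (g zero ∷_) (allColorings m k)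

count-[] : ∀ {k} (p : Coloring 0 k → Bool) → count p ≡ (if p [] then 1 else 0)
count-[] p with p []
... | true = refl
... | false = refl

count-all : ∀ {k} m → count {m} {k} (λ _ → true) ≡ k ^ m
count-all zero = refl
count-all {k} (suc m) = trans (count-cons {m} {k} (λ _ → true))
  (trans (sum-cong-≗ {k} (λ _ → count-all {k} m)) (sum-const {k} (k ^ m)))

count-no-colours : ∀ {m} (p : Coloring (suc m) 0 → Bool) → count p ≡ 0
count-no-colours {m} p = count-cons {m} {0} p

Agree : ∀ {m k} → (Fin m → Bool) → Coloring m k → Coloring m k → Set
Agree A φ ψ = ∀ i → A i ≡ true → lookup φ i ≡ lookup ψ i

DependsOn : ∀ {m k} → (Fin m → Bool) → (Coloring m k → Bool) → Set
DependsOn A g = ∀ φ ψ → Agree A φ ψ → g φ ≡ g ψ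

allV-true : ∀ {n} (p : Fin n → Bool) → allV p ≡ true → ∀ v → p v ≡ true
allV-true {suc n} p eq v with p zero in p0
allV-true {suc n} p eq zero | true = p0
allV-true {suc n} p eq (suc v) | true = allV-true (p ∘ suc) eq v

allV-intro : ∀ {n} (p : Fin n → Bool) → (∀ v → p v ≡ true) → allV p ≡ true
allV-intro {zero} p _ = refl
allV-intro {suc n} p all rewrite all zero = allV-intro (p ∘ suc) (all ∘ suc)

allV-false : ∀ {n} (p : Fin n → Bool) v → p v ≡ false → allV p ≡ false
allV-false {suc n} p zero pv rewrite pv = refl
allV-false {suc n} p (suc v) pv with p zero
... | true = allV-false (p ∘ suc) v pv
... | false = refl

allV-cong : ∀ {n} {p q : Fin n → Bool} → (∀ v → p v ≡ q v) → allV p ≡ allV q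
allV-cong {zero} _ = refl
allV-cong {suc n} p≡q = cong₂ _∧_ (p≡q zero) (allV-cong (p≡q ∘ suc))

-- Shearer with no coordinates left: both sides are 0/1-valued and the left one is
-- 1 only when every g v holds.
shearer-base : ∀ {k n} t .{{_ : NonZero t}} (g : Fin n → Coloring 0 k → Bool) →
  count (λ φ → allV (λ v → g v φ)) ^ t * k ^ (n * 0) ≤ product (λ v → count (g v)) * k ^ (t * 0)
shearer-base {k} {n} t g rewrite *-zeroʳ n | *-zeroʳ t | count-[] (λ φ → allV (λ v → g v φ))
  with allV (λ v → g v []) in all-g
... | false = subst (_≤ product (λ v → count (g v)) * 1) (sym (cong (_* 1) (0^t≡0 t))) z≤n
... | true = ≤-reflexive (cong (_* 1) (trans (^-zeroˡ t) (sym all-one)))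
  where
  counts : ∀ v → count (g v) ≡ 1
  counts v = trans (count-[] (g v)) (cong (λ b → if b then 1 else 0) (allV-true (λ v → g v []) all-g v))
  all-one : product (λ v → count (g v)) ≡ 1
  all-one = trans (product-cong counts) (trans (∏-const {n} 1) (^-zeroˡ n))

countF-compl : ∀ {n} (p : Fin n → Bool) → countF p + countF (not ∘ p) ≡ n
countF-compl {zero} p = refl
countF-compl {suc n} p with p zero
... | true = cong suc (countF-compl (p ∘ suc))
... | false = trans (+-suc _ _) (cong suc (countF-compl (p ∘ suc)))

count-first-irrelevant : ∀ {m k} (A : Fin (suc m) → Bool) (g : Coloring (suc m) k → Bool) →
  DependsOn A g → not (A zero) ≡ true → ∀ c c′ → count (λ φ → g (c ∷ φ)) ≡ count (λ φ → g (c′ ∷ φ))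
count-first-irrelevant A g depends ¬A₀ c c′ = count-cong (λ φ → depends (c ∷ φ) (c′ ∷ φ) (agree φ))
  where
  agree : ∀ φ → Agree A (c ∷ φ) (c′ ∷ φ)
  agree φ zero A₀ = ⊥-elim (not-¬ (sym A₀) (sym ¬A₀))
  agree φ (suc i) _ = refl

-- The induction step of Shearer's inequality, splitting by the colour c of the first
-- coordinate.  Rows v whose set A v misses that coordinate do not depend on c; the
-- t rows containing it are combined over c by Hölder's inequality.
shearer-step : ∀ {k′ n m} t .{{_ : NonZero t}}
  (A : Fin n → Fin (suc m) → Bool) (g : Fin n → Coloring (suc m) (suc k′) → Bool) →
  countF (λ v → A v zero) ≡ t → (∀ v → DependsOn (A v) (g v)) →
  (∀ c → count (λ φ → allV (λ v → g v (c ∷ φ))) ^ t * suc k′ ^ (n * m)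
           ≤ product (λ v → count (λ φ → g v (c ∷ φ))) * suc k′ ^ (t * m)) →
  count (λ φ → allV (λ v → g v φ)) ^ t * suc k′ ^ (n * suc m) ≤ product (λ v → count (g v)) * suc k′ ^ (t * suc m)
shearer-step {k′} {n} {m} .(countF (λ v → A v zero)) A g refl depends induction = begin
  count (λ φ → allV (λ v → g v φ)) ^ t * K ^ (n * suc m)
    ≡⟨ cong₂ (λ x y → x ^ t * y) (count-cons (λ φ → allV (λ v → g v φ)))
             (trans (cong (K ^_) (*-suc n m)) (^-distribˡ-+-* K n (n * m))) ⟩
  sum f ^ t * (K ^ n * K ^ (n * m))              ≡⟨ regroup₁ (sum f ^ t) (K ^ n) (K ^ (n * m)) ⟩
  K ^ n * (K ^ (n * m) * sum f ^ t)              ≤⟨ *-monoʳ-≤ (K ^ n) (hölder (K ^ (n * m)) (B * K ^ (t * m)) f column) ⟩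
  K ^ n * (P * (B * K ^ (t * m)))                ≡⟨ regroup₂ (K ^ n) P B (K ^ (t * m)) ⟩
  P * (K ^ n * B) * K ^ (t * m)                  ≡⟨ cong (λ z → P * z * K ^ (t * m)) (sym unselected-rows) ⟩
  P * (∏⟨ not ∘ p ⟩ rowSum * K ^ t) * K ^ (t * m) ≡⟨ regroup₃ P (∏⟨ not ∘ p ⟩ rowSum) (K ^ t) (K ^ (t * m)) ⟩
  P * ∏⟨ not ∘ p ⟩ rowSum * (K ^ t * K ^ (t * m))
    ≡⟨ cong₂ _*_ (sym (∏-split p rowSum)) (sym (trans (cong (K ^_) (*-suc t m)) (^-distribˡ-+-* K t (t * m)))) ⟩
  product rowSum * K ^ (t * suc m)               ≡⟨ cong (_* K ^ (t * suc m)) (product-cong (λ v → sym (count-cons (g v)))) ⟩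
  product (λ v → count (g v)) * K ^ (t * suc m)  ∎
  where
  open ≤-Reasoning
  regroup₁ : ∀ x y z → x * (y * z) ≡ y * (z * x)
  regroup₁ = solve-∀
  regroup₂ : ∀ x y z w → x * (y * (z * w)) ≡ y * (x * z) * w
  regroup₂ = solve-∀
  regroup₃ : ∀ x y z w → x * (y * z) * w ≡ x * y * (z * w)
  regroup₃ = solve-∀
  regroup₄ : ∀ x y z → x * y * z ≡ x * z * y
  regroup₄ = solve-∀
  K : ℕ
  K = suc k′
  p : Fin n → Bool
  p v = A v zero
  a : Fin n → Fin K → ℕ
  a v c = count (λ φ → g v (c ∷ φ))
  f : Fin K → ℕ
  f c = count (λ φ → allV (λ v → g v (c ∷ φ)))
  open Hölder p a using (t; rowSum; P; hölder)

  -- the rows missing the first coordinate do not see its colour; B is their product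
  B : ℕ
  B = ∏⟨ not ∘ p ⟩ (λ v → a v zero)

  unselected-constant : ∀ v → not (p v) ≡ true → ∀ c → a v c ≡ a v zero
  unselected-constant v ¬pv c = count-first-irrelevant (A v) (g v) (depends v) ¬pv c zero

  -- the induction hypothesis at colour c, in the shape required by Hölder
  column : ∀ c → K ^ (n * m) * f c ^ t ≤ ∏⟨ p ⟩ (λ v → a v c) * (B * K ^ (t * m))
  column c = begin
    K ^ (n * m) * f c ^ t                         ≡⟨ *-comm (K ^ (n * m)) _ ⟩
    f c ^ t * K ^ (n * m)                         ≤⟨ induction c ⟩
    product (λ v → a v c) * K ^ (t * m)           ≡⟨ cong (_* K ^ (t * m)) (∏-split p (λ v → a v c)) ⟩
    ∏⟨ p ⟩ (λ v → a v c) * ∏⟨ not ∘ p ⟩ (λ v → a v c) * K ^ (t * m)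
      ≡⟨ cong (λ z → ∏⟨ p ⟩ (λ v → a v c) * z * K ^ (t * m))
              (∏⟨⟩-cong (not ∘ p) (λ v ¬pv → unselected-constant v ¬pv c)) ⟩
    ∏⟨ p ⟩ (λ v → a v c) * B * K ^ (t * m)        ≡⟨ *-assoc (∏⟨ p ⟩ (λ v → a v c)) B _ ⟩
    ∏⟨ p ⟩ (λ v → a v c) * (B * K ^ (t * m))      ∎

  -- each row missing the first coordinate counts K times its restriction
  unselected-rows : ∏⟨ not ∘ p ⟩ rowSum * K ^ t ≡ K ^ n * B
  unselected-rows = begin-equality
    ∏⟨ not ∘ p ⟩ rowSum * K ^ t                          ≡⟨ cong (_* K ^ t) (∏⟨⟩-cong (not ∘ p) scaled) ⟩
    ∏⟨ not ∘ p ⟩ (λ v → K * a v zero) * K ^ t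
      ≡⟨ cong (_* K ^ t) (∏⟨⟩-scale (not ∘ p) K (λ v → a v zero)) ⟩
    K ^ countF (not ∘ p) * B * K ^ t                      ≡⟨ regroup₄ (K ^ countF (not ∘ p)) B (K ^ t) ⟩
    K ^ countF (not ∘ p) * K ^ t * B                      ≡⟨ cong (_* B) (sym (^-distribˡ-+-* K (countF (not ∘ p)) t)) ⟩
    K ^ (countF (not ∘ p) + t) * B                        ≡⟨ cong (λ e → K ^ e * B) (trans (+-comm _ t) (countF-compl p)) ⟩
    K ^ n * B                                             ∎
    where
    scaled : ∀ v → not (p v) ≡ true → rowSum v ≡ K * a v zero
    scaled v ¬pv = trans (sum-cong-≗ (unselected-constant v ¬pv)) (sum-const {K} (a v zero))

shearer : ∀ {k n} t .{{_ : NonZero t}} m (A : Fin n → Fin m → Bool) (g : Fin n → Coloring m k → Bool) →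
  (∀ i → countF (λ v → A v i) ≡ t) → (∀ v → DependsOn (A v) (g v)) →
  count (λ φ → allV (λ v → g v φ)) ^ t * k ^ (n * m) ≤ product (λ v → count (g v)) * k ^ (t * m)
shearer t zero A g _ _ = shearer-base t g
shearer {zero} {n} t (suc m) A g _ _ = subst (_≤ product (λ v → count (g v)) * 0 ^ (t * suc m))
  (sym (trans (cong (λ x → x ^ t * 0 ^ (n * suc m)) (count-no-colours (λ φ → allV (λ v → g v φ))))
              (cong (_* 0 ^ (n * suc m)) (0^t≡0 t))))
  z≤n
shearer {suc k′} t (suc m) A g cover depends = shearer-step t A g (cover zero) depends λ c →
  shearer t m (λ v i → A v (suc i)) (λ v φ → g v (c ∷ φ)) (cover ∘ suc)
    (λ v φ ψ agree → depends v (c ∷ φ) (c ∷ ψ) λ { zero _ → refl ; (suc i) Ai → agree i Ai })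

-- The multiset image of A under φ, added to a base multiplicity vector M; the
-- base records the colours already chosen for earlier coordinates.
imageFrom : ∀ {m k} → (Fin k → ℕ) → Coloring m k → (Fin m → Bool) → Multiset k
imageFrom M φ A = tabulate (λ c → M c + countF (λ v → A v ∧ ⌊ lookup φ v ≟ c ⌋))

addColour : ∀ {k} → (Fin k → ℕ) → Bool → Fin k → (Fin k → ℕ)
addColour M b c c′ = M c′ + (if b ∧ ⌊ c ≟ c′ ⌋ then 1 else 0)

imageFrom-cons : ∀ {m k} (M : Fin k → ℕ) c (φ : Coloring m k) (A : Fin (suc m) → Bool) →
                 imageFrom M (c ∷ φ) A ≡ imageFrom (addColour M (A zero) c) φ (A ∘ suc)
imageFrom-cons M c φ A = tabulate-cong (λ c′ → sym (+-assoc (M c′) _ _))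

NcountFrom : ∀ {k} → ℕ → Collection k → (Fin k → ℕ) → ℕ
NcountFrom {k} s L M = count {s} {k} (λ f → L (imageFrom M f (λ _ → true)))

NcountFrom-cong : ∀ {k} s (L : Collection k) {M M′ : Fin k → ℕ} → (∀ c → M c ≡ M′ c) →
                  NcountFrom s L M ≡ NcountFrom s L M′
NcountFrom-cong s L M≡M′ = count-cong {s} (λ f → cong L (tabulate-cong (λ c → cong (_+ _) (M≡M′ c))))

NcountFrom-suc : ∀ {k} s (L : Collection k) M → NcountFrom (suc s) L M ≡ sum (λ c → NcountFrom s L (addColour M true c))
NcountFrom-suc {k} s L M = trans (count-cons {s} {k} (λ f → L (imageFrom M f (λ _ → true))))
  (sum-cong-≗ {k} (λ c → count-cong {s} (λ φ → cong L (imageFrom-cons M c φ (λ _ → true)))))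

-- One coordinate, whose colour c goes to the first family if b and to the second otherwise.
NcountFrom-pair-step : ∀ {k} b s₁ s₂ (L₁ L₂ : Collection k) M₁ M₂ →
  sum (λ c → NcountFrom s₁ L₁ (addColour M₁ b c) * NcountFrom s₂ L₂ (addColour M₂ (not b) c))
    ≡ NcountFrom ((if b then 1 else 0) + s₁) L₁ M₁ * NcountFrom ((if not b then 1 else 0) + s₂) L₂ M₂
NcountFrom-pair-step {k} true s₁ s₂ L₁ L₂ M₁ M₂ = begin
  sum (λ c → NcountFrom s₁ L₁ (addColour M₁ true c) * NcountFrom s₂ L₂ (addColour M₂ false c))
    ≡⟨ sum-cong-≗ {k} (λ c → cong (NcountFrom s₁ L₁ (addColour M₁ true c) *_)
                                   (NcountFrom-cong s₂ L₂ (λ c′ → +-identityʳ (M₂ c′)))) ⟩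
  sum (λ c → NcountFrom s₁ L₁ (addColour M₁ true c) * NcountFrom s₂ L₂ M₂)
    ≡⟨ sym (*-distribʳ-sum (NcountFrom s₂ L₂ M₂) (λ c → NcountFrom s₁ L₁ (addColour M₁ true c))) ⟩
  sum (λ c → NcountFrom s₁ L₁ (addColour M₁ true c)) * NcountFrom s₂ L₂ M₂
    ≡⟨ cong (_* NcountFrom s₂ L₂ M₂) (sym (NcountFrom-suc s₁ L₁ M₁)) ⟩
  NcountFrom (suc s₁) L₁ M₁ * NcountFrom s₂ L₂ M₂  ∎
  where open ≡-Reasoning
NcountFrom-pair-step {k} false s₁ s₂ L₁ L₂ M₁ M₂ = begin
  sum (λ c → NcountFrom s₁ L₁ (addColour M₁ false c) * NcountFrom s₂ L₂ (addColour M₂ true c))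
    ≡⟨ sum-cong-≗ {k} (λ c → cong₂ _*_ (NcountFrom-cong s₁ L₁ (λ c′ → +-identityʳ (M₁ c′))) refl) ⟩
  sum (λ c → NcountFrom s₁ L₁ M₁ * NcountFrom s₂ L₂ (addColour M₂ true c))
    ≡⟨ sum-cong-≗ {k} (λ c → *-comm (NcountFrom s₁ L₁ M₁) _) ⟩
  sum (λ c → NcountFrom s₂ L₂ (addColour M₂ true c) * NcountFrom s₁ L₁ M₁)
    ≡⟨ sym (*-distribʳ-sum (NcountFrom s₁ L₁ M₁) (λ c → NcountFrom s₂ L₂ (addColour M₂ true c))) ⟩
  sum (λ c → NcountFrom s₂ L₂ (addColour M₂ true c)) * NcountFrom s₁ L₁ M₁
    ≡⟨ trans (*-comm _ (NcountFrom s₁ L₁ M₁)) (cong (NcountFrom s₁ L₁ M₁ *_) (sym (NcountFrom-suc s₂ L₂ M₂))) ⟩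
  NcountFrom s₁ L₁ M₁ * NcountFrom (suc s₂) L₂ M₂  ∎
  where open ≡-Reasoning

-- The colours on A and on its complement are independent choices: the colourings
-- with φ(A) ∈ 𝓛₁ and φ(∁A) ∈ 𝓛₂ number N(|A|,𝓛₁) · N(|∁A|,𝓛₂) (relative to bases).
count-split : ∀ {k} m (A : Fin m → Bool) (L₁ L₂ : Collection k) M₁ M₂ →
  count (λ φ → L₁ (imageFrom M₁ φ A) ∧ L₂ (imageFrom M₂ φ (not ∘ A)))
    ≡ NcountFrom (countF A) L₁ M₁ * NcountFrom (countF (not ∘ A)) L₂ M₂
count-split zero A L₁ L₂ M₁ M₂ with L₁ (imageFrom M₁ [] A) | L₂ (imageFrom M₂ [] (not ∘ A))
... | true | true = refl
... | true | false = refl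
... | false | _ = refl
count-split {k} (suc m) A L₁ L₂ M₁ M₂ = begin
  count (λ φ → L₁ (imageFrom M₁ φ A) ∧ L₂ (imageFrom M₂ φ (not ∘ A)))
    ≡⟨ count-cons (λ φ → L₁ (imageFrom M₁ φ A) ∧ L₂ (imageFrom M₂ φ (not ∘ A))) ⟩
  sum (λ c → count (λ φ → L₁ (imageFrom M₁ (c ∷ φ) A) ∧ L₂ (imageFrom M₂ (c ∷ φ) (not ∘ A))))
    ≡⟨ sum-cong-≗ {k} (λ c → trans (count-cong (λ φ → cong₂ _∧_ (cong L₁ (imageFrom-cons M₁ c φ A))
                                                              (cong L₂ (imageFrom-cons M₂ c φ (not ∘ A)))))
                                 (count-split m (A ∘ suc) L₁ L₂ (M₁⁺ c) (M₂⁺ c))) ⟩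
  sum (λ c → NcountFrom (countF (A ∘ suc)) L₁ (M₁⁺ c) * NcountFrom (countF (not ∘ A ∘ suc)) L₂ (M₂⁺ c))
    ≡⟨ NcountFrom-pair-step (A zero) (countF (A ∘ suc)) (countF (not ∘ A ∘ suc)) L₁ L₂ M₁ M₂ ⟩
  NcountFrom (countF A) L₁ M₁ * NcountFrom (countF (not ∘ A)) L₂ M₂  ∎
  where
  open ≡-Reasoning
  M₁⁺ M₂⁺ : Fin k → Fin k → ℕ
  M₁⁺ = addColour M₁ (A zero)
  M₂⁺ = addColour M₂ (not (A zero))

-- The colourings with φ(A) ∈ 𝓛: N(|A|,𝓛) choices on A, anything outside.
count-image : ∀ {k} m (A : Fin m → Bool) (L : Collection k) →
  count (λ φ → L (image φ A)) ≡ Ncount (countF A) L * k ^ countF (not ∘ A)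
count-image {k} m A L = begin
  count (λ φ → L (image φ A))
    ≡⟨ count-cong {m} {k} {p = λ φ → L (image φ A)} (λ φ → sym (∧-identityʳ _)) ⟩
  count (λ φ → L (image φ A) ∧ true)
    ≡⟨ count-split m A L (λ _ → true) (λ _ → 0) (λ _ → 0) ⟩
  Ncount (countF A) L * count {countF (not ∘ A)} {k} (λ _ → true)
    ≡⟨ cong (Ncount (countF A) L *_) (count-all (countF (not ∘ A))) ⟩
  Ncount (countF A) L * k ^ countF (not ∘ A)  ∎
  where open ≡-Reasoning

countF-cong : ∀ {n} {p q : Fin n → Bool} → (∀ v → p v ≡ q v) → countF p ≡ countF q
countF-cong {zero} _ = refl
countF-cong {suc n} p≡q = cong₂ _+_ (cong (λ b → if b then 1 else 0) (p≡q zero)) (countF-cong (p≡q ∘ suc))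

image-agree : ∀ {m k} (A : Fin m → Bool) {φ ψ : Coloring m k} → Agree A φ ψ → image φ A ≡ image ψ A
image-agree A {φ} {ψ} agree = tabulate-cong (λ c → countF-cong (λ u → same u c))
  where
  same : ∀ u c → (A u ∧ ⌊ lookup φ u ≟ c ⌋) ≡ (A u ∧ ⌊ lookup ψ u ≟ c ⌋)
  same u c with A u in Au
  ... | true = cong (λ x → ⌊ x ≟ c ⌋) (agree u Au)
  ... | false = refl

neighbourhoods-weighted : ∀ {n k} t .{{_ : NonZero t}} (A : Fin n → Fin n → Bool) (L : Collection k) →
  (∀ u → countF (λ v → A v u) ≡ t) → (∀ v → countF (A v) ≡ t) →
  count (λ φ → allV (λ v → L (image φ (A v)))) ^ t * k ^ (n * n) ≤ Ncount t L ^ n * k ^ (n * n)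
neighbourhoods-weighted {n} {k} t A L cover size = begin
  count (λ φ → allV (λ v → L (image φ (A v)))) ^ t * k ^ (n * n)
    ≤⟨ shearer t n A (λ v φ → L (image φ (A v))) cover (λ v φ ψ agree → cong L (image-agree (A v) {φ} {ψ} agree)) ⟩
  product legal * k ^ (t * n)
    ≡⟨ cong (product legal *_) (trans (sym (^-*-assoc k t n)) (sym (∏-const {n} (k ^ t)))) ⟩
  product legal * product {n} (λ _ → k ^ t)     ≡⟨ sym (product-distrib-* legal (λ _ → k ^ t)) ⟩
  product (λ v → legal v * k ^ t)               ≡⟨ product-cong legal-scaled ⟩
  product {n} (λ _ → N * k ^ n)                 ≡⟨ ∏-const {n} (N * k ^ n) ⟩
  (N * k ^ n) ^ n                               ≡⟨ ^-distribʳ-* N (k ^ n) n ⟩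
  N ^ n * (k ^ n) ^ n                           ≡⟨ cong (N ^ n *_) (^-*-assoc k n n) ⟩
  N ^ n * k ^ (n * n)                           ∎
  where
  open ≤-Reasoning
  N : ℕ
  N = Ncount t L
  legal : Fin n → ℕ
  legal v = count (λ φ → L (image φ (A v)))
  legal-scaled : ∀ v → legal v * k ^ t ≡ N * k ^ n
  legal-scaled v = begin-equality
    legal v * k ^ t                                ≡⟨ cong (_* k ^ t) (count-image n (A v) L) ⟩
    Ncount (countF (A v)) L * k ^ countF (not ∘ A v) * k ^ t
      ≡⟨ cong (λ s → Ncount s L * k ^ countF (not ∘ A v) * k ^ t) (size v) ⟩
    N * k ^ countF (not ∘ A v) * k ^ t             ≡⟨ *-assoc N _ _ ⟩
    N * (k ^ countF (not ∘ A v) * k ^ t)           ≡⟨ cong (N *_) (sym (^-distribˡ-+-* k (countF (not ∘ A v)) t)) ⟩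
    N * k ^ (countF (not ∘ A v) + t)               ≡⟨ cong (λ e → N * k ^ e) (trans (+-comm _ t) complement) ⟩
    N * k ^ n                                      ∎
    where
    complement : t + countF (not ∘ A v) ≡ n
    complement = trans (cong (_+ countF (not ∘ A v)) (sym (size v))) (countF-compl (A v))

neighbourhoods-bound : ∀ {n k} t .{{_ : NonZero t}} (A : Fin n → Fin n → Bool) (L : Collection k) →
  (∀ u → countF (λ v → A v u) ≡ t) → (∀ v → countF (A v) ≡ t) →
  count (λ φ → allV (λ v → L (image φ (A v)))) ^ t ≤ Ncount t L ^ n
neighbourhoods-bound {zero} t A L cover size = *-cancelʳ-≤ _ _ 1 (neighbourhoods-weighted t A L cover size)
neighbourhoods-bound {suc n} {zero} t A L _ _ =
  subst (_≤ Ncount t L ^ suc n)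
    (sym (trans (cong (_^ t) (count-no-colours (λ φ → allV (λ v → L (image φ (A v)))))) (0^t≡0 t))) z≤n
neighbourhoods-bound {suc n} {suc k} t A L cover size =
  *-cancelʳ-≤ _ _ (suc k ^ (suc n * suc n)) {{m^n≢0 (suc k) (suc n * suc n)}} (neighbourhoods-weighted t A L cover size)

≟-sym : ∀ {n} (u v : Fin n) → ⌊ u ≟ v ⌋ ≡ ⌊ v ≟ u ⌋
≟-sym u v with u ≟ v | v ≟ u
... | yes _ | yes _ = refl
... | no _ | no _ = refl
... | yes u≡v | no v≢u = ⊥-elim (v≢u (sym u≡v))
... | no u≢v | yes v≡u = ⊥-elim (u≢v (sym v≡u))

countF-insert : ∀ {n} (q : Fin n → Bool) c → q c ≡ false → countF (λ u → q u ∨ ⌊ u ≟ c ⌋) ≡ suc (countF q)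
countF-insert {suc n} q zero qc rewrite qc = cong suc (countF-cong (λ u → ∨-identityʳ (q (suc u))))
countF-insert {suc n} q (suc c) qc = trans
  (cong₂ _+_ (cong (λ b → if b then 1 else 0) (∨-identityʳ (q zero)))
             (trans (countF-cong shift) (countF-insert (q ∘ suc) c qc)))
  (+-suc _ _)
  where
  shift : ∀ u → (q (suc u) ∨ ⌊ suc u ≟ suc c ⌋) ≡ (q (suc u) ∨ ⌊ u ≟ c ⌋)
  shift u with u ≟ c
  ... | yes refl = refl
  ... | no _ = refl

-- In an r-regular graph the open neighbourhoods have r elements and, by symmetry of
-- adjacency, cover every vertex r times: ℓ(G,𝓛)^r ≤ N(r,𝓛)^n.
ℓ-bound : ∀ r .{{_ : NonZero r}} n {k} (G : Graph n) → Regular r G → (L : Collection k) → ℓ G L ^ r ≤ Ncount r L ^ n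
ℓ-bound r n G regular L = neighbourhoods-bound r (openNbhd G) L
  (λ u → trans (countF-cong (λ v → adj-sym G v u)) (regular u)) regular

-- Closed neighbourhoods have r+1 elements and cover every vertex r+1 times:
-- ℓ_c(G,𝓛)^(r+1) ≤ N(r+1,𝓛)^n.
ℓc-bound : ∀ r n {k} (G : Graph n) → Regular r G → (L : Collection k) → ℓc G L ^ suc r ≤ Ncount (suc r) L ^ n
ℓc-bound r n G regular L = neighbourhoods-bound (suc r) (closedNbhd G) L
  (λ u → trans (countF-cong (λ v → cong₂ _∨_ (adj-sym G v u) (≟-sym u v))) (size u)) size
  where
  size : ∀ v → countF (closedNbhd G v) ≡ suc r
  size v = trans (countF-insert (adj G v) v (adj-irrefl G v)) (cong suc (regular v))

n<ᵇn : ∀ n → (n <ᵇ n) ≡ false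
n<ᵇn zero = refl
n<ᵇn (suc n) = n<ᵇn n

countF-first : ∀ a b → countF {a + b} (λ u → toℕ u <ᵇ a) ≡ a
countF-first zero b = countF-none b
  where
  countF-none : ∀ b → countF {b} (λ u → toℕ u <ᵇ 0) ≡ 0
  countF-none zero = refl
  countF-none (suc b) = countF-none b
countF-first (suc a) b = cong suc (countF-first a b)

allV-two-values : ∀ {n} (B : Fin n → Bool) Y₁ Y₂ {v₁ v₂} → B v₁ ≡ false → B v₂ ≡ true →
                  allV (λ v → if B v then Y₂ else Y₁) ≡ Y₁ ∧ Y₂
allV-two-values B true true _ _ = allV-intro _ both
  where
  both : ∀ v → (if B v then true else true) ≡ true
  both v with B v
  ... | true = refl
  ... | false = refl
allV-two-values B false Y₂ {v₁} Bv₁ _ = allV-false _ v₁ (cong (λ b → if b then Y₂ else false) Bv₁)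
allV-two-values B true false {v₂ = v₂} _ Bv₂ = allV-false _ v₂ (cong (λ b → if b then false else true) Bv₂)

-- In K_{r,r} the neighbourhood of a vertex is the opposite part, so a colouring is
-- legal iff the images of both parts lie in 𝓛: ℓ(K_{r,r},𝓛) = N(r,𝓛)².
ℓ-Krr : ∀ r {k} (L : Collection k) → ℓ (Krr (suc r)) L ≡ Ncount (suc r) L * Ncount (suc r) L
ℓ-Krr r {k} L = begin
  ℓ (Krr R) L                                          ≡⟨ count-cong {R + R} {k} legal ⟩
  count (λ φ → L (image φ B) ∧ L (image φ (not ∘ B)))  ≡⟨ count-split (R + R) B L L (λ _ → 0) (λ _ → 0) ⟩
  Ncount (countF B) L * Ncount (countF (not ∘ B)) L
    ≡⟨ cong₂ (λ s s′ → Ncount s L * Ncount s′ L) (countF-first R R) second-part ⟩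
  Ncount R L * Ncount R L                              ∎
  where
  open ≡-Reasoning
  R : ℕ
  R = suc r
  B : Fin (R + R) → Bool
  B u = toℕ u <ᵇ R
  second-part : countF (not ∘ B) ≡ R
  second-part = +-cancelˡ-≡ R _ _ (trans (cong (_+ countF (not ∘ B)) (sym (countF-first R R))) (countF-compl B))
  B[R]≡false : B (R ↑ʳ (zero {r})) ≡ false
  B[R]≡false = trans (cong (_<ᵇ R) (trans (toℕ-↑ʳ R zero) (+-identityʳ R))) (n<ᵇn R)
  nbhd : ∀ φ v → L (image φ (openNbhd (Krr R) v)) ≡ (if B v then L (image φ (not ∘ B)) else L (image φ B))
  nbhd φ v with B v
  ... | true = refl
  ... | false = refl
  legal : ∀ φ → allV (λ v → L (image φ (openNbhd (Krr R) v))) ≡ (L (image φ B) ∧ L (image φ (not ∘ B)))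
  legal φ = trans (allV-cong (nbhd φ)) (allV-two-values B _ _ {R ↑ʳ zero} {zero} B[R]≡false refl)

-- In K_{r+1} every closed neighbourhood is the whole vertex set: ℓ_c(K_{r+1},𝓛) = N(r+1,𝓛).
ℓc-Kcomplete : ∀ r {k} (L : Collection k) → ℓc (Kcomplete (suc r)) L ≡ Ncount (suc r) L
ℓc-Kcomplete r {k} L = count-cong {suc r} {k} legal
  where
  everything : ∀ (v u : Fin (suc r)) → closedNbhd (Kcomplete (suc r)) v u ≡ true
  everything v u = trans (cong (not ⌊ v ≟ u ⌋ ∨_) (≟-sym u v)) (∨-inverseˡ ⌊ v ≟ u ⌋)
  allV-const : ∀ {n} Y → allV {suc n} (λ _ → Y) ≡ Y
  allV-const {n} true = allV-intro {suc n} (λ _ → true) (λ _ → refl)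
  allV-const false = refl
  legal : ∀ φ → allV (λ v → L (image φ (closedNbhd (Kcomplete (suc r)) v))) ≡ L (image φ (λ _ → true))
  legal φ = trans (allV-cong (λ v → cong L (tabulate-cong (λ c → countF-cong (λ u → whole v u c)))))
                  (allV-const {r} _)
    where
    whole : ∀ v u c → (closedNbhd (Kcomplete (suc r)) v u ∧ ⌊ lookup φ u ≟ c ⌋) ≡ (true ∧ ⌊ lookup φ u ≟ c ⌋)
    whole v u c = cong (_∧ ⌊ lookup φ u ≟ c ⌋) (everything v u)

mainTheorem2 : (r : ℕ) → 1 ≤ r → (n k : ℕ) → (G : Graph n) → Regular r G → (L : Collection k) →
    ((ℓ G L ^ r ≤ Ncount r L ^ n) × (Ncount r L ^ (2 * n) ≡ ℓ (Krr r) L ^ n))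
    × ((ℓc G L ^ suc r ≤ Ncount (suc r) L ^ n) × (Ncount (suc r) L ^ n ≡ ℓc (Kcomplete (suc r)) L ^ n))
mainTheorem2 zero () n k G regular L
mainTheorem2 (suc r) _ n k G regular L =
  (ℓ-bound (suc r) n G regular L , N^2n≡ℓ[Krr]^n) ,
  (ℓc-bound (suc r) n G regular L , cong (_^ n) (sym (ℓc-Kcomplete (suc r) L)))
  where
  N : ℕ
  N = Ncount (suc r) L
  N^2n≡ℓ[Krr]^n : N ^ (2 * n) ≡ ℓ (Krr (suc r)) L ^ n
  N^2n≡ℓ[Krr]^n = begin
    N ^ (2 * n)    ≡⟨ sym (^-*-assoc N 2 n) ⟩
    (N ^ 2) ^ n    ≡⟨ cong (λ x → (N * x) ^ n) (*-identityʳ N) ⟩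
    (N * N) ^ n    ≡⟨ cong (_^ n) (sym (ℓ-Krr r L)) ⟩
    ℓ (Krr (suc r)) L ^ n ∎
    where open ≡-Reasoning
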